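{- Let $\mathcal{S}$ be a finite left regular band of groups with support map $\mathsf{supp}:\mathcal{S}\to\mathcal{T}=\mathcal{S}/\!\sim$. For each $x\in E(\mathcal{S})$, the restriction of $\mathsf{supp}$ to $G_x$ is a group isomorphism $G_x\to G_{\mathsf{supp}(x)}$.
   Context: For $s$ in a finite semigroup, $s^\omega$ is the unique idempotent positive power of $s$. A finite semigroup is a left regular band of groups (LRBG) if $s^\omega s=s$ and $sts^\omega=st$ for all $s,t$. $s\sim t$ iff $s^\omega t=s$ and $t^\omega s=t$, a semigroup congruence; $\mathcal{T}=\mathcal{S}/\!\sim$ (again an LRBG) and $\mathsf{supp}$ is the quotient map. For an idempotent $x$ of $\mathcal{S}$, $G_x=\{s\in\mathcal{S}:s^\omega=x\}$; for an idempotent $X$ of $\mathcal{T}$, $G_X=\{S\in\mathcal{T}:S^\omega=X\}$. -}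

module Defs where

open import Level using (Level; suc; _⊔_)
open import Data.Nat using (ℕ; zero; _!; pred) renaming (suc to sucℕ)
open import Data.Fin using (Fin)
open import Data.Product using (Σ; _×_; _,_)
open import Function.Bundles using (_↔_)
open import Relation.Binary.PropositionalEquality using (_≡_)

record FiniteSemigroup (a : Level) : Set (suc a) where
  infixl 7 _∙_
  infix 4 _∼_
  field
    Carrier : Set a
    size    : ℕ
    finite  : Fin size ↔ Carrier
    _∙_     : Carrier → Carrier → Carrier
    assoc   : ∀ x y z → (x ∙ y) ∙ z ≡ x ∙ (y ∙ z)

  -- positive powers: pow s k = s^(k+1)
  pow : Carrier → ℕ → Carrier
  pow s zero     = s
  pow s (sucℕ k) = pow s k ∙ s

  -- s^ω := s^(size !), which is the unique idempotent positive power of s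
  -- (size ! ≥ 1, and it is a multiple of the period and ≥ the index).
  ω : Carrier → Carrier
  ω s = pow s (pred (size !))

  IsIdempotent : Carrier → Set a
  IsIdempotent x = x ∙ x ≡ x

  IsLRBG : Set a
  IsLRBG = (∀ s → ω s ∙ s ≡ s) × (∀ s t → (s ∙ t) ∙ ω s ≡ s ∙ t)

  _∼_ : Carrier → Carrier → Set a
  s ∼ t = (ω s ∙ t ≡ s) × (ω t ∙ s ≡ t)

  G : Carrier → Set a
  G x = Σ Carrier λ s → ω s ≡ x

  -- T = S/∼ is represented as the setoid (Carrier, ∼); supp is the identity
  -- on representatives. For an element X of T (a representative),
  -- "S ∈ G_X" in T means: the (unique) idempotent positive power of S in T
  -- equals X, i.e. some positive power S^(k+1) is idempotent modulo ∼ and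
  -- is ∼-equivalent to X.
  InGT : Carrier → Carrier → Set a
  InGT X t = Σ ℕ λ k → ((pow t k ∙ pow t k) ∼ pow t k) × (pow t k ∼ X)

-- In an LRBG every s satisfies s^ω s = s = s s^ω and has a right inverse s' with
-- s s' = s^ω, so G_x is a group with identity x: for g, h ∈ G_x, g h has the right
-- inverse h' g', whence (g h)^ω = (g h)^ω g h h' g' = x.  supp is injective on G_x,
-- since g ∼ h gives g = g^ω h = x h = h^ω h = h.  For surjectivity, an element t with
-- supp(t) ∈ G_supp(x) has t^ω ∼ x, i.e. t^ω x = t^ω and x t^ω = x; then x t lies in
-- G_x (as (x t)^ω = x t^ω = x) and is ∼-equivalent to t.
module Submission where

open import Defs
open import Level using (Level)
open import Data.Nat using (ℕ; zero; suc; _+_; _*_; pred; _!)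
open import Data.Nat.Properties using (+-identityʳ; +-suc)
open import Data.Nat.Tactic.RingSolver using (solve-∀)
open import Data.Product using (Σ; _×_; _,_; proj₁; proj₂)
open import Relation.Binary.PropositionalEquality
  using (_≡_; refl; sym; trans; cong; cong₂; subst; module ≡-Reasoning)

module PowerLaws {a : Level} (S : FiniteSemigroup a) where
  open FiniteSemigroup S

  ω-exponent : ℕ
  ω-exponent = pred (size !)

  pow-comm : ∀ s k → pow s k ∙ s ≡ s ∙ pow s k
  pow-comm s zero    = refl
  pow-comm s (suc k) = trans (cong (_∙ s) (pow-comm s k)) (assoc s (pow s k) s)

  pow-idempotent : ∀ {x} → IsIdempotent x → ∀ k → pow x k ≡ x
  pow-idempotent xx zero    = refl
  pow-idempotent xx (suc k) = trans (cong (_∙ _) (pow-idempotent xx k)) xx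

  ω-idempotent-fixed : ∀ {x} → IsIdempotent x → ω x ≡ x
  ω-idempotent-fixed xx = pow-idempotent xx ω-exponent

  pow-identityˡ : ∀ {u s} → u ∙ s ≡ s → ∀ k → u ∙ pow s k ≡ pow s k
  pow-identityˡ us zero    = us
  pow-identityˡ {u} {s} us (suc k) =
    trans (sym (assoc u (pow s k) s)) (cong (_∙ s) (pow-identityˡ us k))

  pow-identityʳ : ∀ {u s} → s ∙ u ≡ s → ∀ k → pow s k ∙ u ≡ pow s k
  pow-identityʳ su zero    = su
  pow-identityʳ {u} {s} su (suc k) =
    trans (assoc (pow s k) s u) (cong (pow s k ∙_) su)

  pow-+ : ∀ s m n → pow s m ∙ pow s n ≡ pow s (suc (m + n))
  pow-+ s m zero    rewrite +-identityʳ m = refl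
  pow-+ s m (suc n) rewrite +-suc m n =
    trans (sym (assoc (pow s m) (pow s n) s)) (cong (_∙ s) (pow-+ s m n))

  -- pow s k is s^(k+1), hence the exponent (n+1)(m+1) - 1.
  pow-pow : ∀ s m n → pow (pow s m) n ≡ pow s (n * suc m + m)
  pow-pow s m zero    = refl
  pow-pow s m (suc n) = trans (cong (_∙ pow s m) (pow-pow s m n))
    (trans (pow-+ s (n * suc m + m) m) (cong (pow s) (exponent m n)))
    where
    exponent : ∀ m n → suc (n * suc m + m + m) ≡ suc n * suc m + m
    exponent = solve-∀

  pow-pow-comm : ∀ s m n → pow (pow s m) n ≡ pow (pow s n) m
  pow-pow-comm s m n =
    trans (pow-pow s m n) (trans (cong (pow s) (exponent m n)) (sym (pow-pow s n m)))
    where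
    exponent : ∀ m n → n * suc m + m ≡ m * suc n + n
    exponent = solve-∀

module LRBGLaws {a : Level} (S : FiniteSemigroup a) (lrbg : FiniteSemigroup.IsLRBG S) where
  open FiniteSemigroup S
  open PowerLaws S
  open ≡-Reasoning

  ω-identityˡ : ∀ s → ω s ∙ s ≡ s
  ω-identityˡ = proj₁ lrbg

  ω-absorbʳ : ∀ s t → (s ∙ t) ∙ ω s ≡ s ∙ t
  ω-absorbʳ = proj₂ lrbg

  ω-identityʳ : ∀ s → s ∙ ω s ≡ s
  ω-identityʳ s = trans (sym (pow-comm s ω-exponent)) (ω-identityˡ s)

  ω-idempotent : ∀ s → IsIdempotent (ω s)
  ω-idempotent s = pow-identityˡ (ω-identityˡ s) ω-exponent

  ∼-refl : ∀ s → s ∼ s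
  ∼-refl s = ω-identityˡ s , ω-identityˡ s

  pow-rightFactor : ∀ s n → Σ Carrier λ s' → s ∙ s' ≡ pow s n
  pow-rightFactor s zero    = ω s , ω-identityʳ s
  pow-rightFactor s (suc n) = pow s n , sym (pow-comm s n)

  ω-rightInverse : ∀ s → Σ Carrier λ s' → s ∙ s' ≡ ω s
  ω-rightInverse s = pow-rightFactor s ω-exponent

  pow-idempotent-∙ˡ : ∀ {x} → IsIdempotent x → ∀ t j → pow (x ∙ t) j ≡ x ∙ pow t j
  pow-idempotent-∙ˡ xx t zero    = refl
  pow-idempotent-∙ˡ {x} xx t (suc j) = begin
    pow (x ∙ t) j ∙ (x ∙ t)       ≡⟨ cong (_∙ (x ∙ t)) (pow-idempotent-∙ˡ xx t j) ⟩
    (x ∙ pow t j) ∙ (x ∙ t)       ≡⟨ sym (assoc _ x t) ⟩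
    ((x ∙ pow t j) ∙ x) ∙ t       ≡⟨ cong (λ z → ((x ∙ pow t j) ∙ z) ∙ t) (sym (ω-idempotent-fixed xx)) ⟩
    ((x ∙ pow t j) ∙ ω x) ∙ t     ≡⟨ cong (_∙ t) (ω-absorbʳ x (pow t j)) ⟩
    (x ∙ pow t j) ∙ t             ≡⟨ assoc x (pow t j) t ⟩
    x ∙ pow t (suc j)             ∎

  ω-idempotent-∙ˡ : ∀ {x} → IsIdempotent x → ∀ t → ω (x ∙ t) ≡ x ∙ ω t
  ω-idempotent-∙ˡ xx t = pow-idempotent-∙ˡ xx t ω-exponent

  ω-pow : ∀ t k → ω (pow t k) ≡ ω t
  ω-pow t k = trans (pow-pow-comm t k ω-exponent) (pow-idempotent (ω-idempotent t) k)

  idempotent-pow≡ω : ∀ t k → IsIdempotent (pow t k) → pow t k ≡ ω t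
  idempotent-pow≡ω t k pp = trans (sym (ω-idempotent-fixed pp)) (ω-pow t k)

  ∼-idempotent⇒idempotent : ∀ {s} → (s ∙ s) ∼ s → IsIdempotent s
  ∼-idempotent⇒idempotent {s} (_ , ss∼s) = begin
    s ∙ s            ≡⟨ cong (_∙ s) (sym (ω-identityˡ s)) ⟩
    (ω s ∙ s) ∙ s    ≡⟨ assoc (ω s) s s ⟩
    ω s ∙ (s ∙ s)    ≡⟨ ss∼s ⟩
    s                ∎

  G⇒InGT : ∀ {x} (g : G x) → InGT x (proj₁ g)
  G⇒InGT (g , refl) = ω-exponent , (subst (_∼ ω g) (sym (ω-idempotent g)) (∼-refl (ω g)) , ∼-refl (ω g))

  G-∙-closed : ∀ {x} (g h : G x) → ω (proj₁ g ∙ proj₁ h) ≡ x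
  G-∙-closed {x} (g , ωg≡x) (h , ωh≡x) = begin
    ω (g ∙ h)                  ≡⟨ sym (pow-identityʳ ghx≡gh ω-exponent) ⟩
    ω (g ∙ h) ∙ x              ≡⟨ cong (ω (g ∙ h) ∙_) (sym ghh'g'≡x) ⟩
    ω (g ∙ h) ∙ ((g ∙ h) ∙ k)  ≡⟨ sym (assoc _ (g ∙ h) k) ⟩
    (ω (g ∙ h) ∙ (g ∙ h)) ∙ k  ≡⟨ cong (_∙ k) (ω-identityˡ (g ∙ h)) ⟩
    (g ∙ h) ∙ k                ≡⟨ ghh'g'≡x ⟩
    x                          ∎
    where
    g' = proj₁ (ω-rightInverse g)
    h' = proj₁ (ω-rightInverse h)
    k  = h' ∙ g'
    gx≡g : g ∙ x ≡ g
    gx≡g = trans (cong (g ∙_) (sym ωg≡x)) (ω-identityʳ g)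
    ghx≡gh : (g ∙ h) ∙ x ≡ g ∙ h
    ghx≡gh = trans (assoc g h x) (cong (g ∙_) (trans (cong (h ∙_) (sym ωh≡x)) (ω-identityʳ h)))
    ghh'g'≡x : (g ∙ h) ∙ k ≡ x
    ghh'g'≡x = begin
      (g ∙ h) ∙ (h' ∙ g')  ≡⟨ assoc g h k ⟩
      g ∙ (h ∙ (h' ∙ g'))  ≡⟨ cong (g ∙_) (sym (assoc h h' g')) ⟩
      g ∙ ((h ∙ h') ∙ g')  ≡⟨ cong (λ z → g ∙ (z ∙ g')) (trans (proj₂ (ω-rightInverse h)) ωh≡x) ⟩
      g ∙ (x ∙ g')         ≡⟨ sym (assoc g x g') ⟩
      (g ∙ x) ∙ g'         ≡⟨ cong (_∙ g') gx≡g ⟩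
      g ∙ g'               ≡⟨ trans (proj₂ (ω-rightInverse g)) ωg≡x ⟩
      x                    ∎

  G-∼⇒≡ : ∀ {x} (g h : G x) → proj₁ g ∼ proj₁ h → proj₁ g ≡ proj₁ h
  G-∼⇒≡ (g , refl) (h , ωh≡ωg) (ωg∙h≡g , _) = begin
    g          ≡⟨ sym ωg∙h≡g ⟩
    ω g ∙ h    ≡⟨ cong (_∙ h) (sym ωh≡ωg) ⟩
    ω h ∙ h    ≡⟨ ω-identityˡ h ⟩
    h          ∎

  InGT⇒G : ∀ {x} → IsIdempotent x → ∀ t → InGT x t → Σ (G x) λ g → proj₁ g ∼ t
  InGT⇒G {x} xx t (k , pp∼p , (ωp∙x≡p , ωx∙p≡x)) =
    (x ∙ t , ω[xt]≡x) , (cong (_∙ t) ω[xt]≡x , ωt∙xt≡t)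
    where
    p≡ωt : pow t k ≡ ω t
    p≡ωt = idempotent-pow≡ω t k (∼-idempotent⇒idempotent pp∼p)
    ωt∙x≡ωt : ω t ∙ x ≡ ω t
    ωt∙x≡ωt = begin
      ω t ∙ x             ≡⟨ cong (_∙ x) (sym (ω-pow t k)) ⟩
      ω (pow t k) ∙ x     ≡⟨ ωp∙x≡p ⟩
      pow t k             ≡⟨ p≡ωt ⟩
      ω t                 ∎
    x∙ωt≡x : x ∙ ω t ≡ x
    x∙ωt≡x = trans (cong₂ _∙_ (sym (ω-idempotent-fixed xx)) (sym p≡ωt)) ωx∙p≡x
    ω[xt]≡x : ω (x ∙ t) ≡ x
    ω[xt]≡x = trans (ω-idempotent-∙ˡ xx t) x∙ωt≡x
    ωt∙xt≡t : ω t ∙ (x ∙ t) ≡ t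
    ωt∙xt≡t = trans (sym (assoc (ω t) x t)) (trans (cong (_∙ t) ωt∙x≡ωt) (ω-identityˡ t))

proposition3p14 : ∀ {a : Level} (S : FiniteSemigroup a) →
    let open FiniteSemigroup S in
    IsLRBG → (x : Carrier) → IsIdempotent x →
    ((g : G x) → InGT x (proj₁ g))
    × ((g h : G x) → ω (proj₁ g ∙ proj₁ h) ≡ x)
    × ((g h : G x) → proj₁ g ∼ proj₁ h → proj₁ g ≡ proj₁ h)
    × ((t : Carrier) → InGT x t → Σ (G x) λ g → proj₁ g ∼ t)
proposition3p14 S lrbg x xx = G⇒InGT , G-∙-closed , G-∼⇒≡ , InGT⇒G xx
  where open LRBGLaws S lrbg
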